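{- Let $M\rightarrow M'$ be a matroid perspective on a finite linearly ordered set $E$. Let $B\subseteq E$ be independent in $M$ and spanning in $M'$, and let $A\subseteq E$ satisfy $B\setminus\mathrm{Int}_{M'}(B)\subseteq A\subseteq B\cup\mathrm{Ext}_M(B)$. Then (i) $\mathrm{Int}_{M'}(A)=\mathrm{Int}_{M'}(B)\cap A$; (ii) $P_{M'}(A)=\mathrm{Int}_{M'}(B)\setminus A$; (iii) $\mathrm{Ext}_M(A)=\mathrm{Ext}_M(B)\setminus A$; (iv) $Q_M(A)=\mathrm{Ext}_M(B)\cap A$.
   Context: A matroid perspective $M\rightarrow M'$ is a pair of matroids $M,M'$ on the same finite set $E$ such that every circuit of $M$ is a union of circuits of $M'$ (equivalently, no circuit of $M$ and cocircuit of $M'$ intersect in exactly one element). For a matroid $N$ on $E$ and $A\subseteq E$: $P_N(A)$ is the set of $e\in E\setminus A$ that are the smallest element of some cocircuit of $N$ contained in $E\setminus A$; $Q_N(A)$ is the set of $e\in A$ that are the smallest element of some circuit of $N$ contained in $A$; $\mathrm{Ext}_N(A)$ is the set of $e\in E\setminus A$ that are the smallest element of some circuit of $N$ contained in $A\cup\{e\}$; $\mathrm{Int}_N(A)$ is the set of $e\in A$ that are the smallest element of some cocircuit of $N$ contained in $(E\setminus A)\cup\{e\}$. -}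

module Defs where

open import Data.Nat using (ℕ; _<_)
open import Data.Fin using (Fin; _≤_)
open import Data.Fin.Subset using (Subset; _∈_; _∉_; _⊆_; _⊂_; _∪_; ∁; ⁅_⁆; ∣_∣; ⊥)
open import Data.Product using (Σ; ∃; _×_; _,_)
open import Relation.Nullary using (¬_; Dec)

-- A (finite) matroid on the ground set E = Fin n, linearly ordered by the
-- natural order of Fin n, given by the independent-set axioms.
record Matroid (n : ℕ) : Set₁ where
  field
    Indep       : Subset n → Set
    indep?      : (A : Subset n) → Dec (Indep A)
    indep-empty : Indep ⊥
    indep-sub   : ∀ {A B} → A ⊆ B → Indep B → Indep A
    indep-aug   : ∀ {A B} → Indep A → Indep B → ∣ A ∣ < ∣ B ∣ →
                  ∃ λ e → e ∈ B × e ∉ A × Indep (A ∪ ⁅ e ⁆)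

module _ {n : ℕ} (N : Matroid n) where
  open Matroid N

  IsCircuit : Subset n → Set
  IsCircuit C = ¬ Indep C × (∀ D → D ⊂ C → Indep D)

  IsBasis : Subset n → Set
  IsBasis B = Indep B × (∀ C → B ⊆ C → Indep C → C ⊆ B)

  Spanning : Subset n → Set
  Spanning S = ∃ λ B → IsBasis B × B ⊆ S

  MeetsAllBases : Subset n → Set
  MeetsAllBases C = ∀ B → IsBasis B → ∃ λ e → e ∈ C × e ∈ B

  -- cocircuit: minimal set meeting every basis (= circuit of the dual)
  IsCocircuit : Subset n → Set
  IsCocircuit C = MeetsAllBases C × (∀ D → D ⊂ C → ¬ MeetsAllBases D)

IsMin : ∀ {n} → Fin n → Subset n → Set
IsMin e S = e ∈ S × (∀ f → f ∈ S → e ≤ f)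

-- matroid perspective M → M': every circuit of M is a union of circuits of M'
-- (i.e. each of its elements lies in a circuit of M' contained in it)
Perspective : ∀ {n} → Matroid n → Matroid n → Set
Perspective M M' = ∀ C → IsCircuit M C →
  ∀ e → e ∈ C → ∃ λ C' → IsCircuit M' C' × e ∈ C' × C' ⊆ C

module _ {n : ℕ} (N : Matroid n) (A : Subset n) where

  P : Fin n → Set
  P e = e ∉ A × ∃ λ C → IsCocircuit N C × C ⊆ ∁ A × IsMin e C

  Q : Fin n → Set
  Q e = e ∈ A × ∃ λ C → IsCircuit N C × C ⊆ A × IsMin e C

  Ext : Fin n → Set
  Ext e = e ∉ A × ∃ λ C → IsCircuit N C × C ⊆ A ∪ ⁅ e ⁆ × IsMin e C

  Int : Fin n → Set
  Int e = e ∈ A × ∃ λ C → IsCocircuit N C × C ⊆ ∁ A ∪ ⁅ e ⁆ × IsMin e C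

-- For B independent in M and spanning in M', and B ∖ Int_{M'}(B) ⊆ A ⊆ B ∪ Ext_M(B), the active
-- sets of A are read off from those of B: the very same circuits and cocircuits witness them.
--
-- For a perspective, a fundamental circuit of M and a fundamental cocircuit of M' of B never meet in
-- exactly one element; so a circuit witnessing e ∈ Ext_M(B) stays inside A ∪ {e}, and a cocircuit
-- witnessing e ∈ Int_{M'}(B) stays inside (E ∖ A) ∪ {e}. The four equalities follow from these two
-- facts together with the two activity criteria.
module Submission where

open import Defs
open import Data.Nat as ℕ using (ℕ)
import Data.Nat.Properties as ℕP
open import Data.Fin using (Fin; _≤_; _<_)
open import Data.Fin.Properties using (any?; all?; _≟_; _≤?_; _<?_; ≤-refl; ≤-antisym; ≤∧≢⇒<; <-irrefl)
open import Data.Fin.Subset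
  using (Subset; _∈_; _∉_; _⊆_; _⊂_; _⊃_; _∪_; _─_; _-_; ∁; ⁅_⁆; ∣_∣)
open import Data.Fin.Subset.Properties
  using (_∈?_; _⊆?_; _⊂?_; anySubset?; nonempty?; ⊆-refl; ⊆-trans; p⊂q⇒p⊆q; p⊂q⇒∣p∣<∣q∣;
         p⊆p∪q; q⊆p∪q; x∈p∪q⁻; x∈⁅x⁆; x∈⁅y⁆⇒x≡y; x∈∁p⇒x∉p; x∉p⇒x∈∁p; x∉∁p⇒x∈p;
         p─q⊆p; x∈p⇒p-x⊂p; x∈p∧x≢y⇒x∈p-y)
open import Data.Fin.Subset.Induction using (Acc; acc; ⊂-wellFounded; ⊃-wellFounded)
open import Data.Vec using (_∷_; tabulate; here; there)
open import Data.Vec.Properties using (lookup∘tabulate; lookup⇒[]=; []=⇒lookup)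
open import Data.Bool using (true)
open import Data.Product using (∃; _×_; _,_; proj₁; proj₂)
open import Data.Sum using (_⊎_; inj₁; inj₂; [_,_]′)
open import Data.Empty using (⊥-elim) renaming (⊥ to Void)
open import Function using (id)
open import Function.Bundles using (_⇔_; mk⇔)
open import Relation.Nullary using (¬_; Dec; yes; no; does; ¬?)
open import Relation.Nullary.Decidable using (dec-true; decidable-stable; _×-dec_; _→-dec_)
open import Relation.Binary.PropositionalEquality using (_≡_; _≢_; refl; sym; trans; subst)

x∈p─q⇒x∉q : ∀ {n} {x : Fin n} (p q : Subset n) → x ∈ p ─ q → x ∉ q
x∈p─q⇒x∉q (_ ∷ p) (true ∷ q) () here
x∈p─q⇒x∉q (_ ∷ p) (_ ∷ q) (there x∈) (there x∈q) = x∈p─q⇒x∉q p q x∈ x∈q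

module _ {n : ℕ} where

  subset : {P : Fin n → Set} → (∀ i → Dec (P i)) → Subset n
  subset P? = tabulate (λ i → does (P? i))

  ∈subset⁺ : {P : Fin n → Set} (P? : ∀ i → Dec (P i)) {i : Fin n} → P i → i ∈ subset P?
  ∈subset⁺ P? {i} p = lookup⇒[]= i _ (trans (lookup∘tabulate _ i) (dec-true (P? i) p))

  ∈subset⁻ : {P : Fin n → Set} (P? : ∀ i → Dec (P i)) {i : Fin n} → i ∈ subset P? → P i
  ∈subset⁻ P? {i} i∈ with P? i | trans (sym (lookup∘tabulate (λ j → does (P? j)) i)) ([]=⇒lookup i∈)
  ... | yes p | _ = p
  ... | no _  | ()

  x∈p-y⇒x≢y : {x y : Fin n} (p : Subset n) → x ∈ p - y → x ≢ y
  x∈p-y⇒x≢y {y = y} p x∈ refl = x∈p─q⇒x∉q p ⁅ y ⁆ x∈ (x∈⁅x⁆ y)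

  ∈∪⁅⁆⁻ : {x y : Fin n} {p : Subset n} → x ∈ p ∪ ⁅ y ⁆ → x ∈ p ⊎ x ≡ y
  ∈∪⁅⁆⁻ {y = y} {p} x∈ with x∈p∪q⁻ p ⁅ y ⁆ x∈
  ... | inj₁ x∈p = inj₁ x∈p
  ... | inj₂ x∈y = inj₂ (x∈⁅y⁆⇒x≡y y x∈y)

  ∪-lub : {p q r : Subset n} → p ⊆ r → q ⊆ r → p ∪ q ⊆ r
  ∪-lub {p} {q} p⊆r q⊆r x∈ with x∈p∪q⁻ p q x∈
  ... | inj₁ x∈p = p⊆r x∈p
  ... | inj₂ x∈q = q⊆r x∈q

  ⁅⁆⊆ : {x : Fin n} {p : Subset n} → x ∈ p → ⁅ x ⁆ ⊆ p
  ⁅⁆⊆ {x} x∈p y∈ = subst (_∈ _) (sym (x∈⁅y⁆⇒x≡y x y∈)) x∈p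

  ∪⁅⁆-mono : {x : Fin n} {p q : Subset n} → p ⊆ q → p ∪ ⁅ x ⁆ ⊆ q ∪ ⁅ x ⁆
  ∪⁅⁆-mono {x} {q = q} p⊆q = ∪-lub (λ y∈p → p⊆p∪q ⁅ x ⁆ (p⊆q y∈p)) (q⊆p∪q q ⁅ x ⁆)

  ⊆-∪⁅⁆ : {x : Fin n} {p : Subset n} → p ⊆ (p - x) ∪ ⁅ x ⁆
  ⊆-∪⁅⁆ {x} {p} {y} y∈p with y ≟ x
  ... | yes refl = q⊆p∪q (p - y) ⁅ y ⁆ (x∈⁅x⁆ y)
  ... | no y≢x = p⊆p∪q ⁅ x ⁆ (x∈p∧x≢y⇒x∈p-y y∈p y≢x)

  ⊂-∪⁅⁆ : {x : Fin n} {p : Subset n} → x ∉ p → p ⊂ p ∪ ⁅ x ⁆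
  ⊂-∪⁅⁆ {x} {p} x∉p = p⊆p∪q ⁅ x ⁆ , x , q⊆p∪q p ⁅ x ⁆ (x∈⁅x⁆ x) , x∉p

  allSubsets? : {P : Subset n → Set} → (∀ S → Dec (P S)) → Dec (∀ S → P S)
  allSubsets? P? with anySubset? (λ S → ¬? (P? S))
  ... | yes (S , ¬pS) = no (λ all → ¬pS (all S))
  ... | no none = yes (λ S → decidable-stable (P? S) (λ ¬pS → none (S , ¬pS)))

  minimalWithin : {P : Subset n → Set} → (∀ S → Dec (P S)) → ∀ S → P S →
                  ∃ λ D → D ⊆ S × P D × (∀ D' → D' ⊂ D → ¬ P D')
  minimalWithin {P} P? S = go S (⊂-wellFounded S)
    where
    go : ∀ S → Acc _⊂_ S → P S → ∃ λ D → D ⊆ S × P D × (∀ D' → D' ⊂ D → ¬ P D')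
    go S (acc smaller) pS with anySubset? (λ D → D ⊂? S ×-dec P? D)
    ... | no none = S , ⊆-refl , pS , λ D' D'⊂S pD' → none (D' , D'⊂S , pD')
    ... | yes (D , D⊂S , pD) with go D (smaller D⊂S) pD
    ...   | D₀ , D₀⊆D , rest = D₀ , ⊆-trans D₀⊆D (p⊂q⇒p⊆q D⊂S) , rest

  maximalAbove : {P : Subset n → Set} → (∀ S → Dec (P S)) → ∀ S → P S →
                 ∃ λ T → S ⊆ T × P T × (∀ x → x ∉ T → ¬ P (T ∪ ⁅ x ⁆))
  maximalAbove {P} P? S = go S (⊃-wellFounded S)
    where
    go : ∀ S → Acc _⊃_ S → P S → ∃ λ T → S ⊆ T × P T × (∀ x → x ∉ T → ¬ P (T ∪ ⁅ x ⁆))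
    go S (acc larger) pS with any? (λ x → ¬? (x ∈? S) ×-dec P? (S ∪ ⁅ x ⁆))
    ... | no none = S , ⊆-refl , pS , λ x x∉S pSx → none (x , x∉S , pSx)
    ... | yes (x , x∉S , pSx) with go (S ∪ ⁅ x ⁆) (larger (⊂-∪⁅⁆ x∉S)) pSx
    ...   | T , Sx⊆T , rest = T , (λ y∈S → Sx⊆T (p⊆p∪q ⁅ x ⁆ y∈S)) , rest

module MatroidTheory {n : ℕ} (N : Matroid n) where
  open Matroid N

  isBasis? : ∀ B → Dec (IsBasis N B)
  isBasis? B = indep? B ×-dec allSubsets? (λ C → B ⊆? C →-dec (indep? C →-dec C ⊆? B))

  meetsAllBases? : ∀ Z → Dec (MeetsAllBases N Z)
  meetsAllBases? Z = allSubsets? (λ B → isBasis? B →-dec any? (λ x → x ∈? Z ×-dec x ∈? B))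

  isCocircuit? : ∀ D → Dec (IsCocircuit N D)
  isCocircuit? D = meetsAllBases? D ×-dec allSubsets? (λ D' → D' ⊂? D →-dec ¬? (meetsAllBases? D'))

  isMin? : ∀ (e : Fin n) S → Dec (IsMin e S)
  isMin? e S = e ∈? S ×-dec all? (λ f → f ∈? S →-dec e ≤? f)

  int? : ∀ B (e : Fin n) → Dec (Int N B e)
  int? B e = e ∈? B ×-dec anySubset? (λ D → isCocircuit? D ×-dec (D ⊆? ∁ B ∪ ⁅ e ⁆ ×-dec isMin? e D))

  meetsAllBases-stable : ∀ Z → (∀ B → IsBasis N B → (∀ x → x ∈ Z → x ∉ B) → Void) → MeetsAllBases N Z
  meetsAllBases-stable Z noneAvoids B bB =
    decidable-stable (any? (λ x → x ∈? Z ×-dec x ∈? B))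
      (λ ¬meet → noneAvoids B bB (λ x x∈Z x∈B → ¬meet (x , x∈Z , x∈B)))

  circuitWithin : ∀ S → ¬ Indep S → ∃ λ C → IsCircuit N C × C ⊆ S
  circuitWithin S dS with minimalWithin (λ X → ¬? (indep? X)) S dS
  ... | C , C⊆S , dC , minimal =
    C , (dC , λ D D⊂C → decidable-stable (indep? D) (minimal D D⊂C)) , C⊆S

  cocircuitWithin : ∀ Z → MeetsAllBases N Z → ∃ λ D → IsCocircuit N D × D ⊆ Z
  cocircuitWithin Z mZ with minimalWithin meetsAllBases? Z mZ
  ... | D , D⊆Z , mD , minimal = D , (mD , minimal) , D⊆Z

  extendWithin : ∀ H J → Indep J → J ⊆ H →
    ∃ λ J' → J ⊆ J' × J' ⊆ H × Indep J' × (∀ x → x ∈ H → x ∉ J' → ¬ Indep (J' ∪ ⁅ x ⁆))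
  extendWithin H J iJ J⊆H with maximalAbove (λ X → X ⊆? H ×-dec indep? X) J (J⊆H , iJ)
  ... | J' , J⊆J' , (J'⊆H , iJ') , maximal =
    J' , J⊆J' , J'⊆H , iJ' , λ x x∈H x∉J' iJ'x → maximal x x∉J' (∪-lub J'⊆H (⁅⁆⊆ x∈H) , iJ'x)

  basisBySize : ∀ B J → IsBasis N B → Indep J → ∣ B ∣ ℕ.≤ ∣ J ∣ → IsBasis N J
  basisBySize B J (iB , maxB) iJ ∣B∣≤∣J∣ = iJ , λ C J⊆C iC {x} x∈C → inJ C J⊆C iC x x∈C
    where
    inJ : ∀ C → J ⊆ C → Indep C → ∀ x → x ∈ C → x ∈ J
    inJ C J⊆C iC x x∈C with x ∈? J
    ... | yes x∈J = x∈J
    ... | no x∉J with indep-aug iB (indep-sub (∪-lub J⊆C (⁅⁆⊆ x∈C)) iC)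
                                   (ℕP.≤-<-trans ∣B∣≤∣J∣ (p⊂q⇒∣p∣<∣q∣ (⊂-∪⁅⁆ x∉J)))
    ...   | y , _ , y∉B , iBy = ⊥-elim (y∉B (maxB (B ∪ ⁅ y ⁆) (p⊆p∪q ⁅ y ⁆) iBy (q⊆p∪q B ⁅ y ⁆ (x∈⁅x⁆ y))))

  noBasisAvoids : ∀ D e J → MeetsAllBases N D → Indep J → J ⊆ ∁ D → ¬ Indep (J ∪ ⁅ e ⁆) →
                  ∀ B → IsBasis N B → (∀ x → x ∈ D - e → x ∉ B) → Void
  noBasisAvoids D e J meetsD iJ J⊆∁D dJe B bB avoids with extendWithin (∁ D) J iJ J⊆∁D
  ... | J' , J⊆J' , J'⊆∁D , iJ' , maximal with ∣ B ∣ ℕ.≤? ∣ J' ∣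
  ...   | yes ∣B∣≤∣J'∣ = J'missesD (meetsD J' (basisBySize B J' bB iJ' ∣B∣≤∣J'∣))
    where
    J'missesD : (∃ λ x → x ∈ D × x ∈ J') → Void
    J'missesD (x , x∈D , x∈J') = x∈∁p⇒x∉p (J'⊆∁D x∈J') x∈D
  ...   | no ∣B∣≰∣J'∣ with indep-aug iJ' (proj₁ bB) (ℕP.≰⇒> ∣B∣≰∣J'∣)
  ...     | f , f∈B , f∉J' , iJ'f with f ≟ e | f ∈? D
  ...       | yes refl | _ = dJe (indep-sub (∪⁅⁆-mono J⊆J') iJ'f)
  ...       | no f≢e | yes f∈D = avoids f (x∈p∧x≢y⇒x∈p-y f∈D f≢e) f∈B
  ...       | no _ | no f∉D = maximal f (x∉p⇒x∈∁p f∉D) f∉J' iJ'f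

  -- Cocircuit exchange: an independent J meeting the cocircuit D at most in e ∈ D remains
  -- independent after adding e (otherwise D - e would already meet every basis).
  addAcrossCocircuit : ∀ D e J → IsCocircuit N D → e ∈ D → Indep J →
                       (∀ g → g ∈ D → g ∈ J → g ≡ e) → Indep (J ∪ ⁅ e ⁆)
  addAcrossCocircuit D e J (meetsD , minimalD) e∈D iJ J∩D⊆e =
    decidable-stable (indep? (J ∪ ⁅ e ⁆)) λ dJe →
      minimalD (D - e) (x∈p⇒p-x⊂p e∈D)
        (meetsAllBases-stable (D - e) (noBasisAvoids D e J meetsD iJ (J⊆∁D dJe) dJe))
    where
    J⊆∁D : ¬ Indep (J ∪ ⁅ e ⁆) → J ⊆ ∁ D
    J⊆∁D dJe {g} g∈J = x∉p⇒x∈∁p λ g∈D →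
      dJe (indep-sub (∪-lub ⊆-refl (⁅⁆⊆ (subst (_∈ J) (J∩D⊆e g g∈D g∈J) g∈J))) iJ)

  orthogonal : ∀ C D e → IsCircuit N C → IsCocircuit N D → e ∈ C → e ∈ D →
               (∀ g → g ∈ C → g ∈ D → g ≡ e) → Void
  orthogonal C D e (dC , minimalC) cD e∈C e∈D C∩D⊆e =
    dC (indep-sub ⊆-∪⁅⁆ (addAcrossCocircuit D e (C - e) cD e∈D (minimalC (C - e) (x∈p⇒p-x⊂p e∈C))
          λ g g∈D g∈C-e → C∩D⊆e g (p─q⊆p C ⁅ e ⁆ g∈C-e) g∈D))

  -- For independent S, Spans S t says t lies in the closure of S.
  Spans : Subset n → Fin n → Set
  Spans S t = t ∈ S ⊎ ¬ Indep (S ∪ ⁅ t ⁆)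

  spannedIsSmaller : ∀ S J → Indep S → Indep J → (∀ x → x ∈ J → Spans S x) → ∣ J ∣ ℕ.≤ ∣ S ∣
  spannedIsSmaller S J iS iJ spanned with ∣ J ∣ ℕ.≤? ∣ S ∣
  ... | yes ∣J∣≤∣S∣ = ∣J∣≤∣S∣
  ... | no ∣J∣≰∣S∣ with indep-aug iS iJ (ℕP.≰⇒> ∣J∣≰∣S∣)
  ...   | x , x∈J , x∉S , iSx with spanned x x∈J
  ...     | inj₁ x∈S = ⊥-elim (x∉S x∈S)
  ...     | inj₂ dSx = ⊥-elim (dSx iSx)

  spans-trans : ∀ S T e → Indep S → Indep T → (∀ t → t ∈ T → Spans S t) → ¬ Indep (T ∪ ⁅ e ⁆) →
                Spans S e
  spans-trans S T e iS iT spansT dTe with e ∈? S | indep? (S ∪ ⁅ e ⁆)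
  ... | yes e∈S | _ = inj₁ e∈S
  ... | no _ | no dSe = inj₂ dSe
  ... | no e∉S | yes iSe with extendWithin (S ∪ T) T iT (q⊆p∪q S T)
  ...   | J , T⊆J , J⊆S∪T , iJ , maximal
          with indep-aug iJ iSe (ℕP.≤-<-trans (spannedIsSmaller S J iS iJ
                                   (λ x x∈J → [ inj₁ , spansT x ]′ (x∈p∪q⁻ S T (J⊆S∪T x∈J))))
                                 (p⊂q⇒∣p∣<∣q∣ (⊂-∪⁅⁆ e∉S)))
  ...     | x , x∈S∪e , x∉J , iJx with ∈∪⁅⁆⁻ x∈S∪e
  ...       | inj₁ x∈S = ⊥-elim (maximal x (p⊆p∪q T x∈S) x∉J iJx)
  ...       | inj₂ refl = ⊥-elim (dTe (indep-sub (∪⁅⁆-mono T⊆J) iJx))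

  Isolated : Subset n → Fin n → Set
  Isolated X b = ∃ λ D → IsCocircuit N D × b ∈ D × (∀ g → g ∈ D → g ∈ X → g ≡ b)

  isolated-mono : ∀ {X X' b} → X' ⊆ X → Isolated X b → Isolated X' b
  isolated-mono X'⊆X (D , cD , b∈D , D∩X⊆b) = D , cD , b∈D , λ g g∈D g∈X' → D∩X⊆b g g∈D (X'⊆X g∈X')

  -- Adding to an independent J a set Y each of whose points is isolated in J ∪ Y keeps
  -- independence (remove one point, use induction, and add it back across its cocircuit).
  independentIfIsolated : ∀ J Y → Indep J → (∀ b → b ∈ Y → Isolated (J ∪ Y) b) → Indep (J ∪ Y)
  independentIfIsolated J Y iJ = go Y (⊂-wellFounded Y)
    where
    go : ∀ Y → Acc _⊂_ Y → (∀ b → b ∈ Y → Isolated (J ∪ Y) b) → Indep (J ∪ Y)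
    go Y (acc smaller) isolated with nonempty? Y
    ... | no empty = indep-sub (∪-lub ⊆-refl (λ y∈Y → ⊥-elim (empty (_ , y∈Y)))) iJ
    ... | yes (x , x∈Y) with isolated x x∈Y
    ...   | D , cD , x∈D , D∩JY⊆x =
      indep-sub (∪-lub (λ g∈J → p⊆p∪q ⁅ x ⁆ (p⊆p∪q (Y - x) g∈J))
                       (λ g∈Y → ∪⁅⁆-mono (q⊆p∪q J (Y - x)) (⊆-∪⁅⁆ g∈Y)))
        (addAcrossCocircuit D x (J ∪ (Y - x)) cD x∈D
          (go (Y - x) (smaller (x∈p⇒p-x⊂p x∈Y))
            (λ b b∈ → isolated-mono J∪[Y-x]⊆J∪Y (isolated b (p─q⊆p Y ⁅ x ⁆ b∈))))
          (λ g g∈D g∈ → D∩JY⊆x g g∈D (J∪[Y-x]⊆J∪Y g∈)))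
      where
      J∪[Y-x]⊆J∪Y : J ∪ (Y - x) ⊆ J ∪ Y
      J∪[Y-x]⊆J∪Y = ∪-lub (p⊆p∪q Y) (λ g∈ → q⊆p∪q J Y (p─q⊆p Y ⁅ x ⁆ g∈))

  extOfDependent : ∀ B e S → Indep B → S ⊆ B → (∀ g → g ∈ S → e < g) → ¬ Indep (S ∪ ⁅ e ⁆) →
                   Ext N B e
  extOfDependent B e S iB S⊆B S>e dSe with circuitWithin (S ∪ ⁅ e ⁆) dSe
  ... | C , cC , C⊆S∪e = e∉B , C , cC , ⊆-trans C⊆S∪e (∪⁅⁆-mono S⊆B) , e∈C , minC
    where
    e∉B : e ∉ B
    e∉B e∈B = dSe (indep-sub (∪-lub S⊆B (⁅⁆⊆ e∈B)) iB)
    C⊆S : e ∉ C → C ⊆ S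
    C⊆S e∉C {g} g∈C with ∈∪⁅⁆⁻ (C⊆S∪e g∈C)
    ... | inj₁ g∈S = g∈S
    ... | inj₂ refl = ⊥-elim (e∉C g∈C)
    e∈C : e ∈ C
    e∈C = decidable-stable (e ∈? C) λ e∉C → proj₁ cC (indep-sub (⊆-trans (C⊆S e∉C) S⊆B) iB)
    minC : ∀ f → f ∈ C → e ≤ f
    minC f f∈C with ∈∪⁅⁆⁻ (C⊆S∪e f∈C)
    ... | inj₁ f∈S = ℕP.<⇒≤ (S>e f f∈S)
    ... | inj₂ refl = ≤-refl

  extOfCircuit : ∀ B e C → Indep B → IsCircuit N C → IsMin e C →
                 (∀ t → t ∈ C → t ≢ e → t ∈ B ⊎ Ext N B t) → Ext N B e
  extOfCircuit B e C iB cC (e∈C , minC) active = extOfDependent B e S iB S⊆B S>e dSe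
    where
    S? : ∀ g → Dec (g ∈ B × e < g)
    S? g = g ∈? B ×-dec e <? g
    S : Subset n
    S = subset S?
    S⊆B : S ⊆ B
    S⊆B g∈S = proj₁ (∈subset⁻ S? g∈S)
    S>e : ∀ g → g ∈ S → e < g
    S>e g g∈S = proj₂ (∈subset⁻ S? g∈S)
    e<t : ∀ {t} → t ∈ C - e → e < t
    e<t {t} t∈ = ≤∧≢⇒< (minC t (p─q⊆p C ⁅ e ⁆ t∈)) (λ e≡t → x∈p-y⇒x≢y C t∈ (sym e≡t))
    -- Every t ∈ C - e is spanned by S: either t ∈ S, or its own circuit lies in S ∪ {t}.
    spansT : ∀ t → t ∈ C - e → Spans S t
    spansT t t∈ with active t (p─q⊆p C ⁅ e ⁆ t∈) (x∈p-y⇒x≢y C t∈)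
    ... | inj₁ t∈B = inj₁ (∈subset⁺ S? (t∈B , e<t t∈))
    ... | inj₂ (_ , Ct , cCt , Ct⊆B∪t , (_ , minCt)) =
      inj₂ (λ iSt → proj₁ cCt (indep-sub Ct⊆S∪t iSt))
      where
      Ct⊆S∪t : Ct ⊆ S ∪ ⁅ t ⁆
      Ct⊆S∪t {g} g∈Ct with ∈∪⁅⁆⁻ (Ct⊆B∪t g∈Ct)
      ... | inj₂ refl = q⊆p∪q S ⁅ g ⁆ (x∈⁅x⁆ g)
      ... | inj₁ g∈B = p⊆p∪q ⁅ t ⁆ (∈subset⁺ S? (g∈B , ℕP.<-≤-trans (e<t t∈) (minCt g g∈Ct)))
    dSe : ¬ Indep (S ∪ ⁅ e ⁆)
    dSe with spans-trans S (C - e) e (indep-sub S⊆B iB) (proj₂ cC (C - e) (x∈p⇒p-x⊂p e∈C)) spansT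
                         (λ iT → proj₁ cC (indep-sub ⊆-∪⁅⁆ iT))
    ... | inj₁ e∈S = ⊥-elim (<-irrefl refl (S>e e e∈S))
    ... | inj₂ d = d

  intOfTransversal : ∀ B e Z → Spanning N B → Z ⊆ ∁ B ∪ ⁅ e ⁆ → (∀ g → g ∈ Z → e ≤ g) →
                     MeetsAllBases N Z → Int N B e
  intOfTransversal B e Z (B₀ , bB₀ , B₀⊆B) Z⊆ Z≥e mZ with cocircuitWithin Z mZ
  ... | D , cD , D⊆Z with proj₁ cD B₀ bB₀
  ...   | g , g∈D , g∈B₀ with ∈∪⁅⁆⁻ (Z⊆ (D⊆Z g∈D))
  ...     | inj₁ g∈∁B = ⊥-elim (x∈∁p⇒x∉p g∈∁B (B₀⊆B g∈B₀))
  ...     | inj₂ refl = B₀⊆B g∈B₀ , D , cD , ⊆-trans D⊆Z Z⊆ , g∈D , λ f f∈D → Z≥e f (D⊆Z f∈D)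

  intOfCocircuit : ∀ B e D → Spanning N B → IsCocircuit N D → IsMin e D →
                   (∀ b → b ∈ D → b ≢ e → b ∈ B → Int N B b) → Int N B e
  intOfCocircuit B e D spB cD (e∈D , minD) active =
    intOfTransversal B e Z spB (λ g∈Z → proj₂ (∈subset⁻ Z? g∈Z)) (λ g g∈Z → proj₁ (∈subset⁻ Z? g∈Z))
      (meetsAllBases-stable Z noBasisAvoidsZ)
    where
    Z? : ∀ g → Dec (e ≤ g × g ∈ ∁ B ∪ ⁅ e ⁆)
    Z? g = e ≤? g ×-dec g ∈? ∁ B ∪ ⁅ e ⁆
    Z : Subset n
    Z = subset Z?
    -- A basis B₁ avoiding Z would extend by e: B₁ ∖ D plus e is independent by cocircuit exchange,
    -- and each b ∈ B₁ ∩ D is isolated by its own fundamental cocircuit.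
    noBasisAvoidsZ : ∀ B₁ → IsBasis N B₁ → (∀ x → x ∈ Z → x ∉ B₁) → Void
    noBasisAvoidsZ B₁ (iB₁ , maxB₁) avoids = e∉B₁ (maxB₁ K B₁⊆K iK e∈K)
      where
      above : ∀ g → g ∈ B₁ → e ≤ g → g ∈ B × g ≢ e
      above g g∈B₁ e≤g =
        x∉∁p⇒x∈p (λ g∈∁B → notInZ (p⊆p∪q ⁅ e ⁆ g∈∁B)) , λ { refl → notInZ (q⊆p∪q (∁ B) ⁅ g ⁆ (x∈⁅x⁆ g)) }
        where
        notInZ : g ∈ ∁ B ∪ ⁅ e ⁆ → Void
        notInZ g∈ = avoids g (∈subset⁺ Z? (e≤g , g∈)) g∈B₁
      e∉B₁ : e ∉ B₁
      e∉B₁ e∈B₁ = proj₂ (above e e∈B₁ ≤-refl) refl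
      J? : ∀ g → Dec (g ∈ B₁ × g ∉ D)
      J? g = g ∈? B₁ ×-dec ¬? (g ∈? D)
      Y? : ∀ g → Dec (g ∈ B₁ × g ∈ D)
      Y? g = g ∈? B₁ ×-dec g ∈? D
      J Y K : Subset n
      J = subset J?
      Y = subset Y?
      K = (J ∪ ⁅ e ⁆) ∪ Y
      B₁⊆K : B₁ ⊆ K
      B₁⊆K {g} g∈B₁ with g ∈? D
      ... | yes g∈D = q⊆p∪q (J ∪ ⁅ e ⁆) Y (∈subset⁺ Y? (g∈B₁ , g∈D))
      ... | no g∉D = p⊆p∪q Y (p⊆p∪q ⁅ e ⁆ (∈subset⁺ J? (g∈B₁ , g∉D)))
      e∈K : e ∈ K
      e∈K = p⊆p∪q Y (q⊆p∪q J ⁅ e ⁆ (x∈⁅x⁆ e))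
      K⊆B₁∪e : ∀ {g} → g ∈ K → g ∈ B₁ ⊎ g ≡ e
      K⊆B₁∪e {g} g∈K with x∈p∪q⁻ (J ∪ ⁅ e ⁆) Y g∈K
      ... | inj₂ g∈Y = inj₁ (proj₁ (∈subset⁻ Y? g∈Y))
      ... | inj₁ g∈J∪e = [ (λ g∈J → inj₁ (proj₁ (∈subset⁻ J? g∈J))) , inj₂ ]′ (∈∪⁅⁆⁻ g∈J∪e)
      iJ∪e : Indep (J ∪ ⁅ e ⁆)
      iJ∪e = addAcrossCocircuit D e J cD e∈D (indep-sub (λ g∈J → proj₁ (∈subset⁻ J? g∈J)) iB₁)
               (λ g g∈D g∈J → ⊥-elim (proj₂ (∈subset⁻ J? g∈J) g∈D))
      isolated : ∀ b → b ∈ Y → Isolated K b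
      isolated b b∈Y with ∈subset⁻ Y? b∈Y
      ... | b∈B₁ , b∈D with above b b∈B₁ (minD b b∈D)
      ...   | b∈B , b≢e with active b b∈D b≢e b∈B
      ...     | _ , Db , cDb , Db⊆ , (b∈Db , minDb) = Db , cDb , b∈Db , DbK⊆b
        where
        DbK⊆b : ∀ g → g ∈ Db → g ∈ K → g ≡ b
        DbK⊆b g g∈Db g∈K with ∈∪⁅⁆⁻ (Db⊆ g∈Db)
        ... | inj₂ g≡b = g≡b
        ... | inj₁ g∈∁B = ⊥-elim (x∈∁p⇒x∉p g∈∁B (proj₁ (above g g∈B₁ (ℕP.<⇒≤ e<g))))
          where
          e<g : e < g
          e<g = ℕP.<-≤-trans (≤∧≢⇒< (minD b b∈D) (λ e≡b → b≢e (sym e≡b))) (minDb g g∈Db)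
          g∈B₁ : g ∈ B₁
          g∈B₁ = [ id , (λ { refl → ⊥-elim (<-irrefl refl e<g) }) ]′ (K⊆B₁∪e g∈K)
      iK : Indep K
      iK = independentIfIsolated (J ∪ ⁅ e ⁆) Y iJ∪e isolated

module PerspectiveTheory {n : ℕ} (M M' : Matroid n) (persp : Perspective M M') where

  -- Orthogonality across a perspective: a circuit of M and a cocircuit of M' never meet in
  -- exactly one element (the M'-circuit through that element inside the M-circuit would).
  perspective-orthogonal : ∀ C D e → IsCircuit M C → IsCocircuit M' D → e ∈ C → e ∈ D →
                           (∀ g → g ∈ C → g ∈ D → g ≡ e) → Void
  perspective-orthogonal C D e cC cD e∈C e∈D C∩D⊆e with persp C cC e e∈C
  ... | C' , cC' , e∈C' , C'⊆C =
    MatroidTheory.orthogonal M' C' D e cC' cD e∈C' e∈D (λ g g∈C' g∈D → C∩D⊆e g (C'⊆C g∈C') g∈D)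

  separated : ∀ {B x b C D} → x ∉ B → IsCircuit M C → C ⊆ B ∪ ⁅ x ⁆ → IsMin x C →
              b ∈ B → IsCocircuit M' D → D ⊆ ∁ B ∪ ⁅ b ⁆ → IsMin b D → b ∉ C × x ∉ D
  separated {B} {x} {b} {C} {D} x∉B cC C⊆ (x∈C , minC) b∈B cD D⊆ (b∈D , minD) = b∉C , x∉D
    where
    C∩D⊆xb : ∀ g → g ∈ C → g ∈ D → g ≡ x ⊎ g ≡ b
    C∩D⊆xb g g∈C g∈D with ∈∪⁅⁆⁻ (C⊆ g∈C) | ∈∪⁅⁆⁻ (D⊆ g∈D)
    ... | inj₂ g≡x | _ = inj₁ g≡x
    ... | inj₁ _ | inj₂ g≡b = inj₂ g≡b
    ... | inj₁ g∈B | inj₁ g∈∁B = ⊥-elim (x∈∁p⇒x∉p g∈∁B g∈B)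
    notBoth : b ∈ C → x ∈ D → Void
    notBoth b∈C x∈D with ≤-antisym (minC b b∈C) (minD x x∈D)
    ... | refl = x∉B b∈B
    b∉C : b ∉ C
    b∉C b∈C = perspective-orthogonal C D b cC cD b∈C b∈D λ g g∈C g∈D →
      [ (λ { refl → ⊥-elim (notBoth b∈C g∈D) }) , id ]′ (C∩D⊆xb g g∈C g∈D)
    x∉D : x ∉ D
    x∉D x∈D = perspective-orthogonal C D x cC cD x∈C x∈D λ g g∈C g∈D →
      [ id , (λ { refl → ⊥-elim (notBoth g∈C x∈D) }) ]′ (C∩D⊆xb g g∈C g∈D)

module ActiveSets {n : ℕ} (M M' : Matroid n) (persp : Perspective M M')
  (B A : Subset n) (iB : Matroid.Indep M B) (spB : Spanning M' B)
  (lower : ∀ e → e ∈ B → ¬ Int M' B e → e ∈ A)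
  (upper : ∀ e → e ∈ A → e ∈ B ⊎ Ext M B e) where

  open PerspectiveTheory M M' persp

  internallyActive : ∀ g → g ∈ B → g ∉ A → Int M' B g
  internallyActive g g∈B g∉A =
    decidable-stable (MatroidTheory.int? M' B g) (λ ¬int → g∉A (lower g g∈B ¬int))

  -- A circuit witnessing e ∈ Ext_M(B) lies in A ∪ {e}: its points of B are not internally active.
  extCircuit⊆ : ∀ {e C} → e ∉ B → IsCircuit M C → C ⊆ B ∪ ⁅ e ⁆ → IsMin e C → C ⊆ A ∪ ⁅ e ⁆
  extCircuit⊆ {e} {C} e∉B cC C⊆ minC {g} g∈C with ∈∪⁅⁆⁻ (C⊆ g∈C) | g ∈? A
  ... | inj₂ refl | _ = q⊆p∪q A ⁅ g ⁆ (x∈⁅x⁆ g)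
  ... | inj₁ _ | yes g∈A = p⊆p∪q ⁅ e ⁆ g∈A
  ... | inj₁ g∈B | no g∉A with internallyActive g g∈B g∉A
  ...   | _ , D , cD , D⊆ , minD = ⊥-elim (proj₁ (separated e∉B cC C⊆ minC g∈B cD D⊆ minD) g∈C)

  -- A cocircuit witnessing e ∈ Int_{M'}(B) lies in ∁ A ∪ {e}: its points of A are neither in B
  -- nor externally active.
  intCocircuit⊆ : ∀ {e D} → e ∈ B → IsCocircuit M' D → D ⊆ ∁ B ∪ ⁅ e ⁆ → IsMin e D → D ⊆ ∁ A ∪ ⁅ e ⁆
  intCocircuit⊆ {e} {D} e∈B cD D⊆ minD {g} g∈D with ∈∪⁅⁆⁻ (D⊆ g∈D)
  ... | inj₂ refl = q⊆p∪q (∁ A) ⁅ g ⁆ (x∈⁅x⁆ g)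
  ... | inj₁ g∈∁B = p⊆p∪q ⁅ e ⁆ (x∉p⇒x∈∁p g∉A)
    where
    g∉A : g ∉ A
    g∉A g∈A with upper g g∈A
    ... | inj₁ g∈B = x∈∁p⇒x∉p g∈∁B g∈B
    ... | inj₂ (g∉B , C , cC , C⊆ , minC) = proj₂ (separated g∉B cC C⊆ minC e∈B cD D⊆ minD) g∈D

  extFromA : ∀ {e C} → IsCircuit M C → IsMin e C → C ⊆ A ∪ ⁅ e ⁆ → Ext M B e
  extFromA {e} {C} cC minC C⊆ = MatroidTheory.extOfCircuit M B e C iB cC minC active
    where
    active : ∀ t → t ∈ C → t ≢ e → t ∈ B ⊎ Ext M B t
    active t t∈C t≢e = [ upper t , (λ t≡e → ⊥-elim (t≢e t≡e)) ]′ (∈∪⁅⁆⁻ (C⊆ t∈C))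

  intFromA : ∀ {e D} → IsCocircuit M' D → IsMin e D → D ⊆ ∁ A ∪ ⁅ e ⁆ → Int M' B e
  intFromA {e} {D} cD minD D⊆ = MatroidTheory.intOfCocircuit M' B e D spB cD minD active
    where
    active : ∀ b → b ∈ D → b ≢ e → b ∈ B → Int M' B b
    active b b∈D b≢e b∈B = internallyActive b b∈B
      ([ x∈∁p⇒x∉p , (λ b≡e → ⊥-elim (b≢e b≡e)) ]′ (∈∪⁅⁆⁻ (D⊆ b∈D)))

  int⇔ : ∀ e → Int M' A e ⇔ (Int M' B e × e ∈ A)
  int⇔ e = mk⇔
    (λ (e∈A , D , cD , D⊆ , minD) → intFromA cD minD D⊆ , e∈A)
    (λ ((e∈B , D , cD , D⊆ , minD) , e∈A) → e∈A , D , cD , intCocircuit⊆ e∈B cD D⊆ minD , minD)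

  P⇔ : ∀ e → P M' A e ⇔ (Int M' B e × e ∉ A)
  P⇔ e = mk⇔
    (λ (e∉A , D , cD , D⊆ , minD) → intFromA cD minD (λ g∈D → p⊆p∪q ⁅ e ⁆ (D⊆ g∈D)) , e∉A)
    (λ ((e∈B , D , cD , D⊆ , minD) , e∉A) →
      e∉A , D , cD , ⊆-trans (intCocircuit⊆ e∈B cD D⊆ minD) (∪-lub ⊆-refl (⁅⁆⊆ (x∉p⇒x∈∁p e∉A))) , minD)

  ext⇔ : ∀ e → Ext M A e ⇔ (Ext M B e × e ∉ A)
  ext⇔ e = mk⇔
    (λ (e∉A , C , cC , C⊆ , minC) → extFromA cC minC C⊆ , e∉A)
    (λ ((e∉B , C , cC , C⊆ , minC) , e∉A) → e∉A , C , cC , extCircuit⊆ e∉B cC C⊆ minC , minC)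

  Q⇔ : ∀ e → Q M A e ⇔ (Ext M B e × e ∈ A)
  Q⇔ e = mk⇔
    (λ (e∈A , C , cC , C⊆ , minC) → extFromA cC minC (λ g∈C → p⊆p∪q ⁅ e ⁆ (C⊆ g∈C)) , e∈A)
    (λ ((e∉B , C , cC , C⊆ , minC) , e∈A) →
      e∈A , C , cC , ⊆-trans (extCircuit⊆ e∉B cC C⊆ minC) (∪-lub ⊆-refl (⁅⁆⊆ e∈A)) , minC)

lemma2 : ∀ {n : ℕ} (M M' : Matroid n) → Perspective M M' →
    (B A : Subset n) → Matroid.Indep M B → Spanning M' B →
    (∀ e → e ∈ B → ¬ Int M' B e → e ∈ A) →
    (∀ e → e ∈ A → e ∈ B ⊎ Ext M B e) →
    (∀ e → Int M' A e ⇔ (Int M' B e × e ∈ A))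
    × (∀ e → P M' A e ⇔ (Int M' B e × e ∉ A))
    × (∀ e → Ext M A e ⇔ (Ext M B e × e ∉ A))
    × (∀ e → Q M A e ⇔ (Ext M B e × e ∈ A))
lemma2 M M' persp B A iB spB lower upper = int⇔ , P⇔ , ext⇔ , Q⇔
  where open ActiveSets M M' persp B A iB spB lower upper
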